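{- Let $P=p_0\dots p_{m-1}$ be a pattern over $\Sigma\cup\{?\}$ with $d$ wildcards, let $\mathcal I$ be a partitioning of $[0,m-1]$ satisfying properties (1)–(4) below, let $I=[i,j]\in\mathcal I$, and let $u_I$ be a string such that for every text $T$ and every time $\alpha\ge0$, $\mathcal C(I,\alpha)$ contains no three distinct candidates with a common entrance prefix $u\neq u_I$. Then for every text $T$ and time $\alpha\ge0$, if there are $h\ge3$ candidates $c_1<c_2<\dots<c_h$ in $\mathcal C(I,\alpha)$ whose entrance prefix is $u_I$, then $c_1,c_2,\dots,c_h$ form an arithmetic progression with common difference $\rho_{u_I}$.
   Context: $\Sigma$ is an alphabet and $?\notin\Sigma$ a wildcard symbol matching every character. For a string $S=s_0\dots s_{\ell-1}$ over $\Sigma$, $\rho_S$ is the smallest $i\ge1$ such that $s_j=s_{j+i}$ for all $0\le j\le\ell-i-1$. A partitioning $\mathcal I=(I_0,\dots,I_k)$ of $[0,m-1]$ into nonempty consecutive integer intervals ordered left to right is assumed to satisfy: (1) each $I=[i,j]$ either satisfies $i=j$ with $p_i$ a wildcard, or $p_i\dots p_j$ contains no wildcard (a regular interval); (2) $k=O(d+\log m)$; (3) for each regular interval $I=[i,j]$ with $|I|=j-i+1>1$, the prefix $p_0\dots p_{i-1}$ contains $|I|$ consecutive non-wildcard characters; (4) the set $\{\mu(0),\dots,\mu(k)\}$, where $\mu(x)=\max_{0\le y\le x}|I_y|$, has $O(\log m)$ elements. For a text $T=t_0t_1\dots$ over $\Sigma$, an interval $I=[i,j]\in\mathcal I$ and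 an integer $\alpha\ge0$, the candidate set $\mathcal C(I,\alpha)$ is the set of integers $c\ge0$ with $\alpha-j+1\le c\le\alpha-i+1$ such that for every $0\le k<i$, either $p_k=?$ or $p_k=t_{c+k}$. The entrance prefix of $c\in\mathcal C(I,\alpha)$ is $t_c\dots t_{c+i-1}$. -}

module Defs where

open import Data.Nat using (ℕ; zero; suc; _+_; _∸_; _≤_; _<_)
open import Data.Fin using (Fin; fromℕ<)
open import Data.Maybe using (Maybe; just; nothing)
open import Data.Vec using (Vec; lookup)
open import Data.List using (List; []; _∷_; map; upTo; length)
open import Data.List.Membership.Propositional using (_∈_)
open import Data.List.Relation.Unary.All using (All)
open import Data.List.Relation.Unary.Linked using (Linked)
open import Data.Product using (Σ; ∃; _×_; _,_)
open import Data.Sum using (_⊎_)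
open import Data.Empty using (⊥)
open import Relation.Binary.PropositionalEquality using (_≡_; _≢_)

-- A pattern of length m over A ∪ {?}: the wildcard ? is `nothing`.
Pattern : Set → ℕ → Set
Pattern A m = Vec (Maybe A) m

Text : Set → Set
Text A = ℕ → A

PatAt : ∀ {A m} → Pattern A m → ℕ → Maybe A → Set
PatAt {m = m} P k x = Σ (k < m) λ h → lookup P (fromℕ< h) ≡ x

Wild : ∀ {A m} → Pattern A m → ℕ → Set
Wild P k = PatAt P k nothing

Solid : ∀ {A m} → Pattern A m → ℕ → Set
Solid P k = ∃ λ a → PatAt P k (just a)

Interval : Set
Interval = ℕ × ℕ

Chain : ℕ → ℕ → List Interval → Set
Chain s m [] = s ≡ m
Chain s m ((i , j) ∷ rest) = i ≡ s × i ≤ j × Chain (suc j) m rest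

IsPartitioning : ℕ → List Interval → Set
IsPartitioning m [] = ⊥
IsPartitioning m (I ∷ Is) = Chain 0 m (I ∷ Is)

Regular : ∀ {A m} → Pattern A m → Interval → Set
Regular P (i , j) = ∀ k → i ≤ k → k ≤ j → Solid P k

Property1 : ∀ {A m} → Pattern A m → List Interval → Set
Property1 P Is = All (λ { (i , j) → (i ≡ j × Wild P i) ⊎ Regular P (i , j) }) Is

Property3 : ∀ {A m} → Pattern A m → List Interval → Set
Property3 P Is =
  All (λ { (i , j) → Regular P (i , j) → 1 < suc j ∸ i →
            ∃ λ s → s + (suc j ∸ i) ≤ i × (∀ k → s ≤ k → k < s + (suc j ∸ i) → Solid P k) })
      Is

-- c ∈ 𝓒(I, α) for I = [i, j]:  α - j + 1 ≤ c ≤ α - i + 1 (as integers, c ≥ 0),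
-- and for every 0 ≤ k < i, p_k = ? or p_k = t_{c+k}.
Candidate : ∀ {A m} → Pattern A m → Text A → Interval → ℕ → ℕ → Set
Candidate P T (i , j) α c =
  α + 1 ≤ c + j × c + i ≤ α + 1 ×
  (∀ k → k < i → Wild P k ⊎ PatAt P k (just (T (c + k))))

entrancePrefix : ∀ {A} → Text A → Interval → ℕ → List A
entrancePrefix T (i , j) c = map (λ k → T (c + k)) (upTo i)

IsPeriod : ∀ {A} → List A → ℕ → Set
IsPeriod S r = ∀ j (h : j < length S) (h′ : j + r < length S) →
  Data.List.lookup S (fromℕ< h) ≡ Data.List.lookup S (fromℕ< h′)
  where import Data.List

IsRho : ∀ {A} → List A → ℕ → Set
IsRho S r = 1 ≤ r × IsPeriod S r × (∀ r′ → 1 ≤ r′ → IsPeriod S r′ → r ≤ r′)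

-- Two good candidates a < a + e carry the same window of length i (the entrance
-- prefix u_I), so e is a period of u_I.  Conversely, a period r < e with r + e ≤ i
-- lets the window at a be shifted by r, which produces a good candidate strictly
-- between a and a + e.  Property (3) gives |I| ≤ i, so candidates lie less than i
-- apart, and a third good candidate supplies a second gap e′ with e + e′ ≤ i.
-- Taking the smaller of r and e′ then rules out every period below e, so each gap
-- between consecutive good candidates is the least period ρ_{u_I}.
module Submission where

open import Defs
open import Data.Nat using (ℕ; zero; suc; _+_; _≤_; _<_; _≟_; _≤?_; _<?_; z≤n; s≤s)
open import Data.Nat.Properties
open import Data.Nat.Tactic.RingSolver using (solve-∀)
open import Data.Fin using (fromℕ<)
open import Data.Fin.Properties using (toℕ-fromℕ<)
open import Data.List using (List; []; _∷_; length; applyUpTo)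
import Data.List as List
open import Data.List.Properties using (∷-injective; length-applyUpTo; lookup-applyUpTo; map-upTo)
open import Data.List.Membership.Propositional using (_∈_)
open import Data.List.Relation.Unary.Any using (here; there)
open import Data.List.Relation.Unary.All using (All; _∷_) renaming (lookup to All-lookup)
import Data.List.Relation.Unary.AllPairs as AllPairs
open import Data.List.Relation.Unary.Linked as Linked using (Linked; [-]; _∷_)
open import Data.List.Relation.Unary.Linked.Properties using (Linked⇒AllPairs)
open import Data.Product using (Σ; ∃; _×_; _,_; proj₁; proj₂)
open import Data.Sum using (inj₁; inj₂; map₂)
open import Data.Maybe using (just)
open import Data.Empty using (⊥; ⊥-elim)
open import Relation.Binary.Definitions using (tri<; tri≈; tri>)
open import Relation.Nullary using (¬_; yes; no)
open import Relation.Binary.PropositionalEquality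
open ≡-Reasoning

m<n⇒∃[o]n≡m+suc[o] : ∀ {m n} → m < n → ∃ λ o → n ≡ m + suc o
m<n⇒∃[o]n≡m+suc[o] {m} m<n with m≤n⇒∃[o]m+o≡n m<n
... | o , refl = o , sym (+-suc m o)

IsLeastPositive : (ℕ → Set) → ℕ → Set
IsLeastPositive Q r = 1 ≤ r × Q r × (∀ r′ → 1 ≤ r′ → Q r′ → r ≤ r′)

isLeastPositive-unique : ∀ {Q r s} → IsLeastPositive Q r → IsLeastPositive Q s → r ≡ s
isLeastPositive-unique (1≤r , qr , r-least) (1≤s , qs , s-least) =
  ≤-antisym (r-least _ 1≤s qs) (s-least _ 1≤r qr)

common-gap : ∀ {Q a b xs} →
  Linked (λ x y → ∃ λ e → IsLeastPositive Q e × y ≡ x + e) (a ∷ b ∷ xs) →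
  ∃ λ r → IsLeastPositive Q r × Linked (λ x y → y ≡ x + r) (a ∷ b ∷ xs)
common-gap gaps@((r , r-least , _) ∷ _) =
  r , r-least ,
  Linked.map (λ (e , e-least , y≡x+e) →
                trans y≡x+e (cong (_ +_) (isLeastPositive-unique e-least r-least)))
             gaps

avoid-two : ∀ {Q : ℕ → Set} {x y z} → Q x → Q y → Q z → x ≢ y → x ≢ z → y ≢ z →
            ∀ a b → ∃ λ w → Q w × w ≢ a × w ≢ b
avoid-two {x = x} {y} {z} qx qy qz x≢y x≢z y≢z a b with x ≟ a | x ≟ b
... | no x≢a   | no x≢b = x , qx , x≢a , x≢b
... | yes refl | _ with y ≟ b
...   | no y≢b   = y , qy , ≢-sym x≢y , y≢b
...   | yes refl = z , qz , ≢-sym x≢z , ≢-sym y≢z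
avoid-two {x = x} {y} {z} qx qy qz x≢y x≢z y≢z a b | no x≢a | yes refl with y ≟ a
...   | no y≢a   = y , qy , y≢a , ≢-sym x≢y
...   | yes refl = z , qz , ≢-sym y≢z , ≢-sym x≢z

module GapsBetweenGood {Per Good : ℕ → Set} (n : ℕ)
  (gap-period : ∀ {a e} → Good a → Good (a + e) → Per e)
  (gap-< : ∀ {a e} → Good a → Good (a + e) → e < n)
  (good-shift : ∀ {a e r} → Good a → Good (a + e) → Per r → r < e → r + e ≤ n → Good (a + r))
  where

  NoneBetween : ℕ → ℕ → Set
  NoneBetween a b = ∀ {c} → Good c → a < c → c < b → ⊥

  no-shorter-period : ∀ {a e r} → Good a → Good (a + e) → NoneBetween a (a + e) →
                      1 ≤ r → Per r → r < e → r + e ≤ n → ⊥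
  no-shorter-period {a} ga gb none 1≤r pr r<e r+e≤n =
    none (good-shift ga gb pr r<e r+e≤n) (m<m+n a 1≤r) (+-monoʳ-< a r<e)

  outer-period : ∀ {a e z} → Good a → Good (a + e) → NoneBetween a (a + e) →
                 Good z → z ≢ a → z ≢ a + e → ∃ λ e′ → 1 ≤ e′ × Per e′ × e + e′ ≤ n
  outer-period {a} {e} {z} ga gb none gz z≢a z≢a+e with <-cmp z a | <-cmp z (a + e)
  ... | tri≈ _ z≡a _ | _ = ⊥-elim (z≢a z≡a)
  ... | tri> _ _ a<z | tri< z<a+e _ _ = ⊥-elim (none gz a<z z<a+e)
  ... | tri> _ _ _ | tri≈ _ z≡a+e _ = ⊥-elim (z≢a+e z≡a+e)
  ... | tri< z<a _ _ | _ with m<n⇒∃[o]n≡m+suc[o] z<a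
  ...   | o , refl = suc o , s≤s z≤n , gap-period gz ga ,
                     subst (_≤ n) (+-comm (suc o) e) (<⇒≤ (gap-< gz (subst Good (+-assoc z (suc o) e) gb)))
  outer-period {a} {e} ga gb none gz z≢a z≢a+e | tri> _ _ _ | tri> _ _ a+e<z
    with m<n⇒∃[o]n≡m+suc[o] a+e<z
  ... | o , refl = suc o , s≤s z≤n , gap-period gb gz ,
                   <⇒≤ (gap-< ga (subst Good (+-assoc a e (suc o)) gz))

  gap-least : ∀ {a e} → Good a → Good (a + e) → NoneBetween a (a + e) → 1 ≤ e →
              (∃ λ z → Good z × z ≢ a × z ≢ a + e) → IsLeastPositive Per e
  gap-least {a} {e} ga gb none 1≤e (z , gz , z≢a , z≢a+e)
    with outer-period ga gb none gz z≢a z≢a+e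
  ... | e′ , 1≤e′ , pe′ , e+e′≤n = 1≤e , gap-period ga gb , least
    where
      -- The smaller of r and e′ is a period below e that fits beside e.
      least : ∀ r → 1 ≤ r → Per r → e ≤ r
      least r 1≤r pr with e ≤? r | r ≤? e′
      ... | yes e≤r | _ = e≤r
      ... | no e≰r | yes r≤e′ = ⊥-elim (no-shorter-period ga gb none 1≤r pr (≰⇒> e≰r)
                                  (≤-trans (≤-reflexive (+-comm r e)) (≤-trans (+-monoʳ-≤ e r≤e′) e+e′≤n)))
      ... | no e≰r | no r≰e′ = ⊥-elim (no-shorter-period ga gb none 1≤e′ pe′ (<-trans (≰⇒> r≰e′) (≰⇒> e≰r))
                                  (≤-trans (≤-reflexive (+-comm e′ e)) e+e′≤n))

  consecutive-gaps : ∀ {a xs} → Linked _<_ (a ∷ xs) → All Good (a ∷ xs) →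
    (∀ {c} → Good c → a ≤ c → c ∈ a ∷ xs) →
    (∀ x y → ∃ λ z → Good z × z ≢ x × z ≢ y) →
    Linked (λ x y → ∃ λ e → IsLeastPositive Per e × y ≡ x + e) (a ∷ xs)
  consecutive-gaps {xs = []} _ _ _ _ = [-]
  consecutive-gaps {a} {b ∷ xs} (a<b ∷ sorted) (ga ∷ gb ∷ goods) complete third
    with m<n⇒∃[o]n≡m+suc[o] a<b
  ... | o , refl = (suc o , gap-least ga gb none (s≤s z≤n) (third a (a + suc o)) , refl)
                   ∷ consecutive-gaps sorted (gb ∷ goods) complete′ third
    where
      none : NoneBetween a (a + suc o)
      none gc a<c c<b with complete gc (<⇒≤ a<c)
      ... | here refl = <-irrefl refl a<c
      ... | there (here refl) = <-irrefl refl c<b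
      ... | there (there c∈xs) = <-asym c<b (All-lookup (AllPairs.head (Linked⇒AllPairs <-trans sorted)) c∈xs)
      complete′ : ∀ {c} → Good c → a + suc o ≤ c → c ∈ a + suc o ∷ xs
      complete′ gc b≤c with complete gc (≤-trans (m≤m+n a (suc o)) b≤c)
      ... | here refl = ⊥-elim (<-irrefl refl (<-≤-trans (m<m+n a (s≤s z≤n)) b≤c))
      ... | there c∈b∷xs = c∈b∷xs

module _ {A : Set} where

  Periodic : (ℕ → A) → ℕ → ℕ → Set
  Periodic f n r = ∀ k → k + r < n → f k ≡ f (k + r)

  applyUpTo-≡⇒pointwise : ∀ {f g : ℕ → A} n → applyUpTo f n ≡ applyUpTo g n →
                          ∀ k → k < n → f k ≡ g k
  applyUpTo-≡⇒pointwise (suc n) eq zero    _         = proj₁ (∷-injective eq)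
  applyUpTo-≡⇒pointwise (suc n) eq (suc k) (s≤s k<n) =
    applyUpTo-≡⇒pointwise n (proj₂ (∷-injective eq)) k k<n

  applyUpTo-cong : ∀ {f g : ℕ → A} n → (∀ k → k < n → f k ≡ g k) → applyUpTo f n ≡ applyUpTo g n
  applyUpTo-cong zero    _   = refl
  applyUpTo-cong (suc n) f≗g =
    cong₂ _∷_ (f≗g 0 (s≤s z≤n)) (applyUpTo-cong n (λ k k<n → f≗g (suc k) (s≤s k<n)))

  lookup-applyUpTo-fromℕ< : ∀ (f : ℕ → A) n {k} (k<len : k < length (applyUpTo f n)) →
                            List.lookup (applyUpTo f n) (fromℕ< k<len) ≡ f k
  lookup-applyUpTo-fromℕ< f n k<len = trans (lookup-applyUpTo f n _) (cong f (toℕ-fromℕ< k<len))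

  isPeriod⇒periodic : ∀ (f : ℕ → A) n {r} → IsPeriod (applyUpTo f n) r → Periodic f n r
  isPeriod⇒periodic f n {r} per k k+r<n = begin
    f k                                              ≡⟨ lookup-applyUpTo-fromℕ< f n k<len ⟨
    List.lookup (applyUpTo f n) (fromℕ< k<len)       ≡⟨ per k k<len k+r<len ⟩
    List.lookup (applyUpTo f n) (fromℕ< k+r<len)     ≡⟨ lookup-applyUpTo-fromℕ< f n k+r<len ⟩
    f (k + r)                                        ∎
    where
      k+r<len : k + r < length (applyUpTo f n)
      k+r<len = subst (_ <_) (sym (length-applyUpTo f n)) k+r<n
      k<len : k < length (applyUpTo f n)
      k<len = m+n≤o⇒m≤o (suc k) k+r<len

  periodic⇒isPeriod : ∀ (f : ℕ → A) n {r} → Periodic f n r → IsPeriod (applyUpTo f n) r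
  periodic⇒isPeriod f n {r} per k k<len k+r<len = begin
    List.lookup (applyUpTo f n) (fromℕ< k<len)       ≡⟨ lookup-applyUpTo-fromℕ< f n k<len ⟩
    f k                                              ≡⟨ per k (subst (_ <_) (length-applyUpTo f n) k+r<len) ⟩
    f (k + r)                                        ≡⟨ lookup-applyUpTo-fromℕ< f n k+r<len ⟨
    List.lookup (applyUpTo f n) (fromℕ< k+r<len)     ∎

module _ {A : Set} (T : Text A) where

  window : ℕ → ℕ → A
  window c k = T (c + k)

  SameWindow : ℕ → ℕ → ℕ → Set
  SameWindow n a b = ∀ k → k < n → window a k ≡ window b k

  sameWindow⇒periodic : ∀ {n a e} → SameWindow n a (a + e) → Periodic (window a) n e
  sameWindow⇒periodic {a = a} {e} same k k+e<n = begin
    T (a + k)        ≡⟨ same k (m+n≤o⇒m≤o (suc k) k+e<n) ⟩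
    T (a + e + k)    ≡⟨ cong T (trans (+-assoc a e k) (cong (a +_) (+-comm e k))) ⟩
    T (a + (k + e))  ∎

  -- Beyond the reach of the period r, the shifted window is read off the copy at a + e.
  sameWindow-shift : ∀ {n a e r} → SameWindow n a (a + e) → Periodic (window a) n r →
                     r < e → r + e ≤ n → SameWindow n a (a + r)
  sameWindow-shift {n} {a} {e} {r} same per r<e r+e≤n k k<n with k + r <? n
  ... | yes k+r<n = begin
    T (a + k)        ≡⟨ per k k+r<n ⟩
    T (a + (k + r))  ≡⟨ cong T (trans (cong (a +_) (+-comm k r)) (sym (+-assoc a r k))) ⟩
    T (a + r + k)    ∎
  ... | no k+r≮n with m≤n⇒∃[o]m+o≡n e≤k
    where
      e≤k : e ≤ k
      e≤k = +-cancelʳ-≤ r e k (≤-trans (≤-reflexive (+-comm e r)) (≤-trans r+e≤n (≮⇒≥ k+r≮n)))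
  ... | k′ , refl = begin
    T (a + (e + k′))        ≡⟨ cong T (sym (+-assoc a e k′)) ⟩
    T (a + e + k′)          ≡⟨ same k′ (≤-<-trans (m≤n+m k′ e) k<n) ⟨
    T (a + k′)              ≡⟨ per k′ k′+r<n ⟩
    T (a + (k′ + r))        ≡⟨ same (k′ + r) k′+r<n ⟩
    T (a + e + (k′ + r))    ≡⟨ cong T (reassociate a e k′ r) ⟩
    T (a + r + (e + k′))    ∎
    where
      k′+r<n : k′ + r < n
      k′+r<n = <-≤-trans (+-monoʳ-< k′ r<e) (≤-trans (≤-reflexive (+-comm k′ e)) (<⇒≤ k<n))
      reassociate : ∀ a e k r → a + e + (k + r) ≡ a + r + (e + k)
      reassociate = solve-∀

  entrancePrefix≡applyUpTo : ∀ I c → entrancePrefix T I c ≡ applyUpTo (window c) (proj₁ I)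
  entrancePrefix≡applyUpTo (i , _) c = map-upTo (window c) i

  entrancePrefix-≡⇒sameWindow : ∀ {i j a b} →
    entrancePrefix T (i , j) a ≡ entrancePrefix T (i , j) b → SameWindow i a b
  entrancePrefix-≡⇒sameWindow {i} {j} {a} {b} eq = applyUpTo-≡⇒pointwise i (begin
    applyUpTo (window a) i    ≡⟨ entrancePrefix≡applyUpTo (i , j) a ⟨
    entrancePrefix T (i , j) a ≡⟨ eq ⟩
    entrancePrefix T (i , j) b ≡⟨ entrancePrefix≡applyUpTo (i , j) b ⟩
    applyUpTo (window b) i    ∎)

  sameWindow⇒entrancePrefix-≡ : ∀ {i j a b} →
    SameWindow i a b → entrancePrefix T (i , j) a ≡ entrancePrefix T (i , j) b
  sameWindow⇒entrancePrefix-≡ {i} {j} {a} {b} same = begin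
    entrancePrefix T (i , j) a ≡⟨ entrancePrefix≡applyUpTo (i , j) a ⟩
    applyUpTo (window a) i    ≡⟨ applyUpTo-cong i same ⟩
    applyUpTo (window b) i    ≡⟨ entrancePrefix≡applyUpTo (i , j) b ⟨
    entrancePrefix T (i , j) b ∎

module _ {A : Set} {m : ℕ} (P : Pattern A m) where

  property3⇒j<i+i : ∀ {Is i j} → Property1 P Is → Property3 P Is → (i , j) ∈ Is →
                    i < j → j < i + i
  property3⇒j<i+i {i = i} {j} prop1 prop3 I∈Is i<j with All-lookup prop1 I∈Is
  ... | inj₁ (refl , _) = ⊥-elim (<-irrefl refl i<j)
  ... | inj₂ regular with All-lookup prop3 I∈Is regular (m+n≤o⇒m≤o∸n 2 (s≤s i<j))
  ...   | s , s+|I|≤i , _ =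
    ≤-trans (m≤n+m∸n (suc j) i) (+-monoʳ-≤ i (m+n≤o⇒n≤o s s+|I|≤i))

  module Candidates (T : Text A) (i j α : ℕ) where

    Cand : ℕ → Set
    Cand = Candidate P T (i , j) α

    candidate-spread : ∀ {a b} → Cand a → Cand b → b + i ≤ a + j
    candidate-spread (α+1≤a+j , _ , _) (_ , b+i≤α+1 , _) = ≤-trans b+i≤α+1 α+1≤a+j

    candidates⇒i<j : ∀ {a b} → Cand a → Cand b → a < b → i < j
    candidates⇒i<j {a} ca cb a<b =
      +-cancelˡ-< a i j (<-≤-trans (+-monoˡ-< i a<b) (candidate-spread ca cb))

    candidate-gap-< : j < i + i → ∀ {a e} → Cand a → Cand (a + e) → e < i
    candidate-gap-< j<2i {a} {e} ca cb = +-cancelʳ-< i e i (≤-<-trans e+i≤j j<2i)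
      where
        e+i≤j : e + i ≤ j
        e+i≤j = +-cancelˡ-≤ a (e + i) j
                  (≤-trans (≤-reflexive (sym (+-assoc a e i))) (candidate-spread ca cb))

    candidate-between : ∀ {a b c} → Cand a → Cand b → a ≤ c → c ≤ b → SameWindow T i a c → Cand c
    candidate-between (α+1≤a+j , _ , matches) (_ , b+i≤α+1 , _) a≤c c≤b same =
      ≤-trans α+1≤a+j (+-monoˡ-≤ j a≤c) , ≤-trans (+-monoˡ-≤ i c≤b) b+i≤α+1 ,
      λ k k<i → map₂ (subst (λ t → PatAt P k (just t)) (same k k<i)) (matches k k<i)

    module Good (uI : List A) where

      GoodCandidate : ℕ → Set
      GoodCandidate c = Cand c × entrancePrefix T (i , j) c ≡ uI

      uI≡applyUpTo : ∀ {a} → GoodCandidate a → uI ≡ applyUpTo (window T a) i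
      uI≡applyUpTo {a} (_ , prefix≡uI) = trans (sym prefix≡uI) (entrancePrefix≡applyUpTo T (i , j) a)

      good⇒sameWindow : ∀ {a b} → GoodCandidate a → GoodCandidate b → SameWindow T i a b
      good⇒sameWindow (_ , pa) (_ , pb) = entrancePrefix-≡⇒sameWindow T {j = j} (trans pa (sym pb))

      good-gap-isPeriod : ∀ {a e} → GoodCandidate a → GoodCandidate (a + e) → IsPeriod uI e
      good-gap-isPeriod {a} {e} ga gb =
        subst (λ S → IsPeriod S e) (sym (uI≡applyUpTo ga))
          (periodic⇒isPeriod (window T a) i (sameWindow⇒periodic T (good⇒sameWindow ga gb)))

      good-shift : ∀ {a e r} → GoodCandidate a → GoodCandidate (a + e) → IsPeriod uI r →
                   r < e → r + e ≤ i → GoodCandidate (a + r)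
      good-shift {a} {e} {r} ga gb per r<e r+e≤i =
        candidate-between (proj₁ ga) (proj₁ gb) (m≤m+n a r) (+-monoʳ-≤ a (<⇒≤ r<e)) same ,
        trans (sym (sameWindow⇒entrancePrefix-≡ T {j = j} same)) (proj₂ ga)
        where
          same : SameWindow T i a (a + r)
          same = sameWindow-shift T (good⇒sameWindow ga gb)
                   (isPeriod⇒periodic (window T a) i (subst (λ S → IsPeriod S r) (uI≡applyUpTo ga) per))
                   r<e r+e≤i

lemma12 : (A : Set) (m : ℕ) (P : Pattern A m) (Is : List Interval) →
    IsPartitioning m Is → Property1 P Is → Property3 P Is →
    (I : Interval) → I ∈ Is → (uI : List A) →
    (∀ (T : Text A) (α : ℕ) (u : List A) → u ≢ uI →
      ¬ (Σ ℕ λ c₁ → Σ ℕ λ c₂ → Σ ℕ λ c₃ →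
           c₁ ≢ c₂ × c₁ ≢ c₃ × c₂ ≢ c₃ ×
           (Candidate P T I α c₁ × entrancePrefix T I c₁ ≡ u) ×
           (Candidate P T I α c₂ × entrancePrefix T I c₂ ≡ u) ×
           (Candidate P T I α c₃ × entrancePrefix T I c₃ ≡ u))) →
    ∀ (T : Text A) (α : ℕ) (cs : List ℕ) →
    3 ≤ length cs →
    Linked _<_ cs →
    All (λ c → Candidate P T I α c × entrancePrefix T I c ≡ uI) cs →
    (∀ c → Candidate P T I α c → entrancePrefix T I c ≡ uI → c ∈ cs) →
    ∃ λ r → IsRho uI r × Linked (λ a b → b ≡ a + r) cs
lemma12 _ _ _ _ _ _ _ _ _ _ _ _ _ []              ()                _ _ _
lemma12 _ _ _ _ _ _ _ _ _ _ _ _ _ (_ ∷ [])        (s≤s ())          _ _ _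
lemma12 _ _ _ _ _ _ _ _ _ _ _ _ _ (_ ∷ _ ∷ [])    (s≤s (s≤s ()))    _ _ _
lemma12 A m P Is _ prop1 prop3 (i , j) I∈Is uI _ T α (x ∷ y ∷ z ∷ _) _
        sorted@(x<y ∷ y<z ∷ _) goods@(gx ∷ gy ∷ gz ∷ _) complete =
  common-gap (consecutive-gaps sorted goods (λ gc _ → complete _ (proj₁ gc) (proj₂ gc)) third)
  where
    open Candidates P T i j α
    open Good uI

    j<i+i : j < i + i
    j<i+i = property3⇒j<i+i P prop1 prop3 I∈Is (candidates⇒i<j (proj₁ gx) (proj₁ gy) x<y)

    open GapsBetweenGood {Good = GoodCandidate} i good-gap-isPeriod
      (λ ga gb → candidate-gap-< j<i+i (proj₁ ga) (proj₁ gb)) good-shift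

    third : ∀ a b → ∃ λ w → GoodCandidate w × w ≢ a × w ≢ b
    third = avoid-two gx gy gz (<⇒≢ x<y) (<⇒≢ (<-trans x<y y<z)) (<⇒≢ y<z)
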